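{- Let $P$ be an $n$-element unit interval order whose elements are labeled $1,\dots,n$ so that $\beta(1)\le\beta(2)\le\cdots\le\beta(n)$, where $\beta(y)=\#\{x\in P: x\le_P y\}-\#\{z\in P: z\ge_P y\}$. Then the antiadjacency matrix $A=A(P)=(a_{i,j})_{i,j\in[n]}$, defined by $a_{i,j}=0$ if $i<_P j$ and $a_{i,j}=1$ otherwise, is totally nonnegative.
   Context: A unit interval order is a finite poset with no induced subposet isomorphic to $\mathbf3+\mathbf1$ (disjoint union of a 3-element chain and a 1-element poset) or to $\mathbf2+\mathbf2$ (disjoint union of two 2-element chains). A real matrix is totally nonnegative if all its minors are nonnegative. -}

module Defs where

open import Data.Nat using (ℕ; zero; suc)
open import Data.Fin using (Fin; zero; suc; punchIn; _<_; _≤_)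
open import Data.Fin.Properties using (_≟_)
open import Data.Integer using (ℤ; +_; _-_; _*_; _+_; -_; 0ℤ; 1ℤ) renaming (_≤_ to _≤ℤ_)
open import Data.List using (List; filter; length; foldr; map)
open import Data.Fin using () renaming (zero to f0)
open import Data.List using ()
open import Data.Product using (_×_; ∃; ∃-syntax; _,_)
open import Relation.Binary.Core using (Rel)
open import Relation.Binary.Structures using (IsDecPartialOrder)
open import Relation.Binary.PropositionalEquality using (_≡_)
open import Relation.Nullary using (¬_; Dec; yes; no)
open import Relation.Nullary.Decidable using (⌊_⌋)
open import Level using (0ℓ)
import Data.List as L

allFin : (n : ℕ) → List (Fin n)
allFin n = L.allFin n

record FinPoset (n : ℕ) : Set₁ where
  field
    _≼_ : Rel (Fin n) 0ℓ
    isDecPartialOrder : IsDecPartialOrder _≡_ _≼_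
  open IsDecPartialOrder isDecPartialOrder public using (_≤?_)
  _≺_ : Rel (Fin n) 0ℓ
  x ≺ y = (x ≼ y) × ¬ (x ≡ y)
  _∥_ : Rel (Fin n) 0ℓ
  x ∥ y = ¬ (x ≼ y) × ¬ (y ≼ x)

  _≺?_ : (x y : Fin n) → Dec (x ≺ y)
  x ≺? y with x ≤? y | x ≟ y
  ... | yes p | no q = yes (p , q)
  ... | yes p | yes q = no (λ { (_ , r) → r q })
  ... | no p | _ = no (λ { (r , _) → p r })

  β : Fin n → ℤ
  β y = (+ length (filter (λ x → x ≤? y) (allFin n)))
      - (+ length (filter (λ z → y ≤? z) (allFin n)))

open FinPoset public

No3+1 : ∀ {n} → FinPoset n → Set
No3+1 P = ¬ (∃[ a ] ∃[ b ] ∃[ c ] ∃[ d ]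
  (_≺_ P a b × _≺_ P b c × _∥_ P d a × _∥_ P d b × _∥_ P d c))

No2+2 : ∀ {n} → FinPoset n → Set
No2+2 P = ¬ (∃[ a ] ∃[ b ] ∃[ c ] ∃[ d ]
  (_≺_ P a b × _≺_ P c d × _∥_ P a c × _∥_ P a d × _∥_ P b c × _∥_ P b d))

IsUnitIntervalOrder : ∀ {n} → FinPoset n → Set
IsUnitIntervalOrder P = No3+1 P × No2+2 P

BetaSorted : ∀ {n} → FinPoset n → Set
BetaSorted {n} P = (i j : Fin n) → i ≤ j → β P i ≤ℤ β P j

Matrix : ℕ → ℕ → Set
Matrix m k = Fin m → Fin k → ℤ

antiAdjacency : ∀ {n} → FinPoset n → Matrix n n
antiAdjacency P i j with _≺?_ P i j
... | yes _ = 0ℤ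
... | no _ = 1ℤ

∑ : (n : ℕ) → (Fin n → ℤ) → ℤ
∑ zero f = 0ℤ
∑ (suc n) f = f zero + ∑ n (λ i → f (suc i))

sign : ℕ → ℤ
sign zero = 1ℤ
sign (suc k) = - sign k

det : (n : ℕ) → Matrix n n → ℤ
det zero M = 1ℤ
det (suc n) M = ∑ (suc n) (λ j →
  sign (Data.Fin.toℕ j) * M zero j * det n (λ a b → M (suc a) (punchIn j b)))

StrictlyIncreasing : ∀ {k n} → (Fin k → Fin n) → Set
StrictlyIncreasing {k} r = (a b : Fin k) → a < b → r a < r b

TotallyNonnegative : ∀ {m n} → Matrix m n → Set
TotallyNonnegative {m} {n} A =
  (k : ℕ) (r : Fin k → Fin m) (c : Fin k → Fin n) →
  StrictlyIncreasing r → StrictlyIncreasing c →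
  + 0 ≤ℤ det k (λ a b → A (r a) (c b))

-- The β-sorted labelling makes the strict order monotone in the labels: i ≤ i', j' ≤ j and
-- i' <P j' imply i <P j.  Otherwise a case analysis yields u, v with label u ≤ label v and
-- either v <P u, or u ∥ v with a third element above (or below) only one of them.  In both
-- cases β v < β u, contradicting the labelling: by inclusion–exclusion
-- #↓v + #↑u = #(↓v ∪ ↑u) + #(↓v ∩ ↑u) with ↓v ∩ ↑u = ∅, and ↓v ∪ ↑u ⊆ ↓u ∪ ↑v, either
-- strictly or with ↓u ∩ ↑v ≠ ∅; 3+1 and 2+2 freeness are what give this inclusion.
-- So the 1-entries of A, and of each of its square submatrices, are closed under moving down
-- and to the left.  Expanding the determinant of such a 0/1 matrix along its first row, all
-- minors with a nonzero coefficient coincide, and the alternating sum of the first row (ones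
-- followed by zeros) is 0 or 1; by induction every such determinant is 0 or 1.
module Submission where

open import Defs hiding (_≼_; _≺_; _∥_; _≤?_; _≺?_; β; isDecPartialOrder)
open import Data.Fin.Base as F using (Fin; zero; suc; toℕ; punchIn)
import Data.Fin.Properties as FP
open import Data.Integer.Base as ℤ using (ℤ; 0ℤ; 1ℤ; _*_; -_)
import Data.Integer.Properties as ℤP
open import Data.Integer.Tactic.RingSolver using (solve-∀)
open import Data.List.Base using ([]; _∷_; filter; length)
open import Data.List.Membership.Propositional using (_∈_; lose)
open import Data.List.Membership.Propositional.Properties using (∈-allFin)
open import Data.List.Properties using (filter-none; filter-some)
open import Data.List.Relation.Unary.All using (universal)
open import Data.List.Relation.Unary.Any using (here; there)
open import Data.Nat.Base using (ℕ; zero; suc; _≤_; _<_; _+_; z≤n; s≤s)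
open import Data.Nat.Properties
  using (m≤n⇒m≤1+n; +-suc; +-identityʳ; m≤m+n; m<m+n; ≤⇒≯; <⇒≤; module ≤-Reasoning)
open import Data.Product.Base using (_×_; _,_; proj₁; proj₂; swap)
open import Data.Sum.Base using (_⊎_; inj₁; inj₂; [_,_]) renaming (map to ⊎-map)
open import Function.Base using (_∘_)
open import Level using (0ℓ)
open import Relation.Binary.Core using (Rel; _Preserves_⟶_)
open import Relation.Binary.PropositionalEquality
  using (_≡_; refl; sym; trans; cong; cong₂; subst; subst₂; module ≡-Reasoning)
open import Relation.Binary.Structures using (IsDecPartialOrder)
open import Relation.Nullary using (¬_; yes; no; contradiction)
open import Relation.Unary using (Pred; Decidable; _⊆_; _∪_; _∩_)
open import Relation.Unary.Properties using (_∪?_; _∩?_)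

module _ {a p q} {A : Set a} {P : Pred A p} {Q : Pred A q}
         (P? : Decidable P) (Q? : Decidable Q) where

  length-filter-mono-≤ : P ⊆ Q → ∀ xs → length (filter P? xs) ≤ length (filter Q? xs)
  length-filter-mono-≤ P⊆Q []       = z≤n
  length-filter-mono-≤ P⊆Q (x ∷ xs) with ih ← length-filter-mono-≤ P⊆Q xs | P? x | Q? x
  ... | yes _ | yes _ = s≤s ih
  ... | yes p | no ¬q = contradiction (P⊆Q p) ¬q
  ... | no _  | yes _ = m≤n⇒m≤1+n ih
  ... | no _  | no _  = ih

  length-filter-mono-< : P ⊆ Q → ∀ {x xs} → x ∈ xs → Q x → ¬ P x →
                         length (filter P? xs) < length (filter Q? xs)
  length-filter-mono-< P⊆Q {xs = y ∷ xs} (here refl) qy ¬py with P? y | Q? y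
  ... | yes py | _     = contradiction py ¬py
  ... | no _   | yes _ = s≤s (length-filter-mono-≤ P⊆Q xs)
  ... | no _   | no ¬q = contradiction qy ¬q
  length-filter-mono-< P⊆Q {xs = y ∷ xs} (there x∈xs) qx ¬px
    with ih ← length-filter-mono-< P⊆Q x∈xs qx ¬px | P? y | Q? y
  ... | yes _ | yes _ = s≤s ih
  ... | yes p | no ¬q = contradiction (P⊆Q p) ¬q
  ... | no _  | yes _ = m≤n⇒m≤1+n ih
  ... | no _  | no _  = ih

  length-filter-∪+∩ : ∀ xs → length (filter P? xs) + length (filter Q? xs) ≡
                             length (filter (P? ∪? Q?) xs) + length (filter (P? ∩? Q?) xs)
  length-filter-∪+∩ []       = refl
  length-filter-∪+∩ (x ∷ xs) with ih ← length-filter-∪+∩ xs | P? x | Q? x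
  ... | yes _ | yes _ = cong suc (trans (+-suc _ _) (trans (cong suc ih) (sym (+-suc _ _))))
  ... | yes _ | no _  = cong suc ih
  ... | no _  | yes _ = trans (+-suc _ _) (cong suc ih)
  ... | no _  | no _  = ih

m-n≤o-p⇒m+p≤o+n : ∀ {m n o p} → ℤ.+ m ℤ.- ℤ.+ n ℤ.≤ ℤ.+ o ℤ.- ℤ.+ p → m + p ≤ o + n
m-n≤o-p⇒m+p≤o+n {m} {n} {o} {p} m-n≤o-p = ℤP.drop‿+≤+ (subst₂ ℤ._≤_
  (cancelˡ (ℤ.+ m) (ℤ.+ n) (ℤ.+ p)) (cancelʳ (ℤ.+ o) (ℤ.+ n) (ℤ.+ p))
  (ℤP.+-monoˡ-≤ (ℤ.+ n ℤ.+ ℤ.+ p) m-n≤o-p))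
  where
  cancelˡ : ∀ a b c → (a ℤ.- b) ℤ.+ (b ℤ.+ c) ≡ a ℤ.+ c
  cancelˡ = solve-∀
  cancelʳ : ∀ a b c → (a ℤ.- c) ℤ.+ (b ℤ.+ c) ≡ a ℤ.+ b
  cancelʳ = solve-∀

module UnitIntervalOrder {n} (P : FinPoset n) (no3+1 : No3+1 P) (no2+2 : No2+2 P) where
  open FinPoset P
  open IsDecPartialOrder isDecPartialOrder
    using (antisym) renaming (refl to ≼-refl; trans to ≼-trans)
  open ≤-Reasoning

  ≺⇒⋡ : ∀ {x y} → x ≺ y → ¬ y ≼ x
  ≺⇒⋡ (x≼y , x≢y) y≼x = x≢y (antisym x≼y y≼x)

  ≼-≺-trans : ∀ {x y z} → x ≼ y → y ≺ z → x ≺ z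
  ≼-≺-trans x≼y y≺z = ≼-trans x≼y (proj₁ y≺z) , λ { refl → ≺⇒⋡ y≺z x≼y }

  ≺-≼-trans : ∀ {x y z} → x ≺ y → y ≼ z → x ≺ z
  ≺-≼-trans x≺y y≼z = ≼-trans (proj₁ x≺y) y≼z , λ { refl → ≺⇒⋡ x≺y y≼z }

  ≼-or-≻-or-∥ : ∀ x y → x ≼ y ⊎ y ≺ x ⊎ x ∥ y
  ≼-or-≻-or-∥ x y with x ≤? y | y ≤? x
  ... | yes x≼y | _       = inj₁ x≼y
  ... | no x⋠y  | yes y≼x = inj₂ (inj₁ (y≼x , λ { refl → x⋠y y≼x }))
  ... | no x⋠y  | no y⋠x  = inj₂ (inj₂ (x⋠y , y⋠x))

  ↓ ↑ : Fin n → ℕ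
  ↓ y = length (filter (_≤? y) (allFin n))
  ↑ y = length (filter (y ≤?_) (allFin n))

  ↓∪↑ ↓∩↑ : Fin n → Fin n → ℕ
  ↓∪↑ u v = length (filter ((_≤? u) ∪? (v ≤?_)) (allFin n))
  ↓∩↑ u v = length (filter ((_≤? u) ∩? (v ≤?_)) (allFin n))

  -- β u < β v, with both subtractions moved to the other side
  _β<_ : Rel (Fin n) 0ℓ
  u β< v = ↓ u + ↑ v < ↓ v + ↑ u

  ↓+↑≡↓∪↑+↓∩↑ : ∀ u v → ↓ u + ↑ v ≡ ↓∪↑ u v + ↓∩↑ u v
  ↓+↑≡↓∪↑+↓∩↑ u v = length-filter-∪+∩ (_≤? u) (v ≤?_) (allFin n)

  ↓+↑≡↓∪↑ : ∀ {u v} → ¬ v ≼ u → ↓ u + ↑ v ≡ ↓∪↑ u v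
  ↓+↑≡↓∪↑ {u} {v} v⋠u = begin-equality
    ↓ u + ↑ v          ≡⟨ ↓+↑≡↓∪↑+↓∩↑ u v ⟩
    ↓∪↑ u v + ↓∩↑ u v  ≡⟨ cong (λ zs → ↓∪↑ u v + length zs) ↓∩↑-empty ⟩
    ↓∪↑ u v + 0        ≡⟨ +-identityʳ _ ⟩
    ↓∪↑ u v            ∎
    where
    ↓∩↑-empty : filter ((_≤? u) ∩? (v ≤?_)) (allFin n) ≡ []
    ↓∩↑-empty = filter-none ((_≤? u) ∩? (v ≤?_))
      (universal (λ z (z≼u , v≼z) → v⋠u (≼-trans v≼z z≼u)) (allFin n))

  ↓∪↑-mono-≤ : ∀ {u v u' v'} → (_≼ u) ∪ (v ≼_) ⊆ (_≼ u') ∪ (v' ≼_) → ↓∪↑ u v ≤ ↓∪↑ u' v'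
  ↓∪↑-mono-≤ {u} {v} {u'} {v'} incl =
    length-filter-mono-≤ ((_≤? u) ∪? (v ≤?_)) ((_≤? u') ∪? (v' ≤?_)) incl (allFin n)

  ↓∪↑-mono-< : ∀ {u v u' v'} → (_≼ u) ∪ (v ≼_) ⊆ (_≼ u') ∪ (v' ≼_) →
               ∀ z → z ≼ u' ⊎ v' ≼ z → ¬ (z ≼ u ⊎ v ≼ z) → ↓∪↑ u v < ↓∪↑ u' v'
  ↓∪↑-mono-< {u} {v} {u'} {v'} incl z =
    length-filter-mono-< ((_≤? u) ∪? (v ≤?_)) ((_≤? u') ∪? (v' ≤?_)) incl (∈-allFin z)

  ↓∩↑-nonempty : ∀ {u v z} → z ≼ u → v ≼ z → 0 < ↓∩↑ u v
  ↓∩↑-nonempty {u} {v} {z} z≼u v≼z =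
    filter-some ((_≤? u) ∩? (v ≤?_)) (lose (∈-allFin z) (z≼u , v≼z))

  β-mono-≺ : ∀ {u v} → u ≺ v → u β< v
  β-mono-≺ {u} {v} u≺v@(u≼v , _) = begin-strict
    ↓ u + ↑ v          ≡⟨ ↓+↑≡↓∪↑ (≺⇒⋡ u≺v) ⟩
    ↓∪↑ u v            ≤⟨ ↓∪↑-mono-≤ (⊎-map (λ z≼u → ≼-trans z≼u u≼v) (≼-trans u≼v)) ⟩
    ↓∪↑ v u            <⟨ m<m+n _ (↓∩↑-nonempty u≼v ≼-refl) ⟩
    ↓∪↑ v u + ↓∩↑ v u  ≡⟨ ↓+↑≡↓∪↑+↓∩↑ v u ⟨
    ↓ v + ↑ u          ∎

  β<-witnessed-above : ∀ {x x' y} → x ∥ x' → x' ≺ y → x ∥ y → x' β< x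
  β<-witnessed-above {x} {x'} {y} (x⋠x' , x'⋠x) x'≺y@(x'≼y , _) (x⋠y , y⋠x) = begin-strict
    ↓ x' + ↑ x           ≡⟨ ↓+↑≡↓∪↑ x⋠x' ⟩
    ↓∪↑ x' x             <⟨ ↓∪↑-mono-< [ below , above ] y (inj₂ x'≼y) [ ≺⇒⋡ x'≺y , x⋠y ] ⟩
    ↓∪↑ x x'             ≤⟨ m≤m+n _ _ ⟩
    ↓∪↑ x x' + ↓∩↑ x x'  ≡⟨ ↓+↑≡↓∪↑+↓∩↑ x x' ⟨
    ↓ x + ↑ x'           ∎
    where
    below : ∀ {z} → z ≼ x' → z ≼ x ⊎ x' ≼ z
    below {z} z≼x' with z FP.≟ x' | z ≤? x
    ... | yes refl | _       = inj₂ ≼-refl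
    ... | no _     | yes z≼x = inj₁ z≼x
    ... | no z≢x'  | no z⋠x  = contradiction
      (z , x' , y , x , (z≼x' , z≢x') , x'≺y ,
       ((λ x≼z → x⋠x' (≼-trans x≼z z≼x')) , z⋠x) , (x⋠x' , x'⋠x) , (x⋠y , y⋠x))
      no3+1
    above : ∀ {w} → x ≼ w → w ≼ x ⊎ x' ≼ w
    above {w} x≼w with x FP.≟ w | x' ≤? w
    ... | yes refl | _        = inj₁ ≼-refl
    ... | no _     | yes x'≼w = inj₂ x'≼w
    ... | no x≢w   | no x'⋠w  = contradiction
      (x' , y , x , w , x'≺y , (x≼w , x≢w) , (x'⋠x , x⋠x') ,
       (x'⋠w , λ w≼x' → x⋠x' (≼-trans x≼w w≼x')) , (y⋠x , x⋠y) ,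
       ((λ y≼w → x'⋠w (≼-trans x'≼y y≼w)) , λ w≼y → x⋠y (≼-trans x≼w w≼y)))
      no2+2

  β<-witnessed-below : ∀ {x y y'} → y ∥ y' → x ≺ y' → x ∥ y → y β< y'
  β<-witnessed-below {x} {y} {y'} (y⋠y' , y'⋠y) x≺y'@(x≼y' , _) (x⋠y , y⋠x) = begin-strict
    ↓ y + ↑ y'           ≡⟨ ↓+↑≡↓∪↑ y'⋠y ⟩
    ↓∪↑ y y'             <⟨ ↓∪↑-mono-< [ below , above ] x (inj₁ x≼y') [ x⋠y , ≺⇒⋡ x≺y' ] ⟩
    ↓∪↑ y' y             ≤⟨ m≤m+n _ _ ⟩
    ↓∪↑ y' y + ↓∩↑ y' y  ≡⟨ ↓+↑≡↓∪↑+↓∩↑ y' y ⟨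
    ↓ y' + ↑ y           ∎
    where
    below : ∀ {z} → z ≼ y → z ≼ y' ⊎ y ≼ z
    below {z} z≼y with z FP.≟ y | z ≤? y'
    ... | yes refl | _        = inj₂ ≼-refl
    ... | no _     | yes z≼y' = inj₁ z≼y'
    ... | no z≢y   | no z⋠y'  = contradiction
      (x , y' , z , y , x≺y' , (z≼y , z≢y) ,
       ((λ x≼z → x⋠y (≼-trans x≼z z≼y)) , λ z≼x → z⋠y' (≼-trans z≼x x≼y')) , (x⋠y , y⋠x) ,
       ((λ y'≼z → y'⋠y (≼-trans y'≼z z≼y)) , z⋠y') , (y'⋠y , y⋠y'))
      no2+2
    above : ∀ {w} → y' ≼ w → w ≼ y' ⊎ y ≼ w
    above {w} y'≼w with y' FP.≟ w | y ≤? w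
    ... | yes refl | _       = inj₁ ≼-refl
    ... | no _     | yes y≼w = inj₂ y≼w
    ... | no y'≢w  | no y⋠w  = contradiction
      (x , y' , w , y , x≺y' , (y'≼w , y'≢w) , (y⋠x , x⋠y) , (y⋠y' , y'⋠y) ,
       (y⋠w , λ w≼y → y'⋠y (≼-trans y'≼w w≼y)))
      no3+1

  module _ (sorted : BetaSorted P) where

    ≤⇒¬β> : ∀ {u v} → u F.≤ v → ¬ v β< u
    ≤⇒¬β> {u} {v} u≤v = ≤⇒≯ (m-n≤o-p⇒m+p≤o+n {↓ u} {↑ u} {↓ v} {↑ v} (sorted u v u≤v))

    ≺-closedˡ : ∀ {x x' y} → x F.≤ x' → x' ≺ y → x ≺ y
    ≺-closedˡ {x} {x'} {y} x≤x' x'≺y with ≼-or-≻-or-∥ x x'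
    ... | inj₁ x≼x'        = ≼-≺-trans x≼x' x'≺y
    ... | inj₂ (inj₁ x'≺x) = contradiction (β-mono-≺ x'≺x) (≤⇒¬β> x≤x')
    ... | inj₂ (inj₂ x∥x') with ≼-or-≻-or-∥ x y
    ...   | inj₁ x≼y        = x≼y , λ { refl → proj₂ x∥x' (proj₁ x'≺y) }
    ...   | inj₂ (inj₁ y≺x) = contradiction (≼-trans (proj₁ x'≺y) (proj₁ y≺x)) (proj₂ x∥x')
    ...   | inj₂ (inj₂ x∥y) = contradiction (β<-witnessed-above x∥x' x'≺y x∥y) (≤⇒¬β> x≤x')

    ≺-closedʳ : ∀ {x y' y} → y' F.≤ y → x ≺ y' → x ≺ y
    ≺-closedʳ {x} {y'} {y} y'≤y x≺y' with ≼-or-≻-or-∥ y' y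
    ... | inj₁ y'≼y        = ≺-≼-trans x≺y' y'≼y
    ... | inj₂ (inj₁ y≺y') = contradiction (β-mono-≺ y≺y') (≤⇒¬β> y'≤y)
    ... | inj₂ (inj₂ y'∥y) with ≼-or-≻-or-∥ x y
    ...   | inj₁ x≼y        = x≼y , λ { refl → proj₂ y'∥y (proj₁ x≺y') }
    ...   | inj₂ (inj₁ y≺x) = contradiction (≼-trans (proj₁ y≺x) (proj₁ x≺y')) (proj₂ y'∥y)
    ...   | inj₂ (inj₂ x∥y) =
      contradiction (β<-witnessed-below (swap y'∥y) x≺y' x∥y) (≤⇒¬β> y'≤y)

    ≺-closed : ∀ {i i' j j'} → i F.≤ i' → j' F.≤ j → i' ≺ j' → i ≺ j
    ≺-closed i≤i' j'≤j = ≺-closedʳ j'≤j ∘ ≺-closedˡ i≤i'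

Is01 : ℤ → Set
Is01 x = x ≡ 0ℤ ⊎ x ≡ 1ℤ

Is01⇒0≤ : ∀ {x} → Is01 x → 0ℤ ℤ.≤ x
Is01⇒0≤ (inj₁ refl) = ℤP.≤-refl
Is01⇒0≤ (inj₂ refl) = ℤ.+≤+ z≤n

Is01-* : ∀ {x y} → Is01 x → Is01 y → Is01 (x * y)
Is01-* (inj₁ refl) _   = inj₁ refl
Is01-* (inj₂ refl) y01 = subst Is01 (sym (ℤP.*-identityˡ _)) y01

Is01-1- : ∀ {x} → Is01 x → Is01 (1ℤ ℤ.- x)
Is01-1- (inj₁ refl) = inj₂ refl
Is01-1- (inj₂ refl) = inj₁ refl

∑-cong : ∀ k {f g : Fin k → ℤ} → (∀ i → f i ≡ g i) → ∑ k f ≡ ∑ k g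
∑-cong zero    f≗g = refl
∑-cong (suc k) f≗g = cong₂ ℤ._+_ (f≗g zero) (∑-cong k (f≗g ∘ suc))

∑-zero : ∀ k {f : Fin k → ℤ} → (∀ i → f i ≡ 0ℤ) → ∑ k f ≡ 0ℤ
∑-zero zero    f≗0 = refl
∑-zero (suc k) f≗0 = cong₂ ℤ._+_ (f≗0 zero) (∑-zero k (f≗0 ∘ suc))

∑-neg : ∀ k (f : Fin k → ℤ) → ∑ k (λ i → - f i) ≡ - ∑ k f
∑-neg zero    f = refl
∑-neg (suc k) f = trans (cong (λ s → - f zero ℤ.+ s) (∑-neg k (f ∘ suc)))
                        (sym (ℤP.neg-distrib-+ (f zero) (∑ k (f ∘ suc))))

∑-*ʳ : ∀ k (f : Fin k → ℤ) c → ∑ k (λ i → f i * c) ≡ ∑ k f * c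
∑-*ʳ zero    f c = refl
∑-*ʳ (suc k) f c = trans (cong (λ s → f zero * c ℤ.+ s) (∑-*ʳ k (f ∘ suc) c))
                         (sym (ℤP.*-distribʳ-+ c (f zero) (∑ k (f ∘ suc))))

det-cong : ∀ k {M N : Matrix k k} → (∀ a b → M a b ≡ N a b) → det k M ≡ det k N
det-cong zero    M≗N = refl
det-cong (suc k) M≗N = ∑-cong (suc k) λ j →
  cong₂ (λ m d → sign (toℕ j) * m * d) (M≗N zero j)
        (det-cong k λ a b → M≗N (suc a) (punchIn j b))

alternating-sum-01 : ∀ k (g : Fin k → ℤ) → (∀ j → Is01 (g j)) →
                     (∀ {j j'} → j' F.≤ j → g j ≡ 1ℤ → g j' ≡ 1ℤ) →
                     Is01 (∑ k λ j → sign (toℕ j) * g j)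
alternating-sum-01 zero    g g01 g-closed = inj₁ refl
alternating-sum-01 (suc k) g g01 g-closed with g01 zero
... | inj₁ g₀≡0 =
  inj₁ (∑-zero (suc k) λ j → trans (cong (sign (toℕ j) *_) (g≡0 j)) (ℤP.*-zeroʳ (sign (toℕ j))))
  where
  g≡0 : ∀ j → g j ≡ 0ℤ
  g≡0 j with g01 j
  ... | inj₁ gⱼ≡0 = gⱼ≡0
  ... | inj₂ gⱼ≡1 = contradiction (trans (sym g₀≡0) (g-closed z≤n gⱼ≡1)) λ ()
... | inj₂ g₀≡1 = subst Is01 (sym ∑≡1-∑tail)
  (Is01-1- (alternating-sum-01 k (g ∘ suc) (g01 ∘ suc) (g-closed ∘ s≤s)))
  where
  open ≡-Reasoning
  ∑≡1-∑tail : ∑ (suc k) (λ j → sign (toℕ j) * g j) ≡ 1ℤ ℤ.- ∑ k (λ j → sign (toℕ j) * g (suc j))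
  ∑≡1-∑tail = begin
    1ℤ * g zero ℤ.+ ∑ k (λ j → - sign (toℕ j) * g (suc j))
      ≡⟨ cong₂ ℤ._+_ (trans (ℤP.*-identityˡ _) g₀≡1)
                     (∑-cong k λ j → sym (ℤP.neg-distribˡ-* (sign (toℕ j)) (g (suc j)))) ⟩
    1ℤ ℤ.+ ∑ k (λ j → - (sign (toℕ j) * g (suc j)))
      ≡⟨ cong (λ s → 1ℤ ℤ.+ s) (∑-neg k λ j → sign (toℕ j) * g (suc j)) ⟩
    1ℤ ℤ.- ∑ k (λ j → sign (toℕ j) * g (suc j)) ∎

record Staircase {m k} (M : Matrix m k) : Set where
  field
    entry-01       : ∀ a b → Is01 (M a b)
    ones-down-left : ∀ {a a' b b'} → a F.≤ a' → b' F.≤ b → M a b ≡ 1ℤ → M a' b' ≡ 1ℤ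

open Staircase

staircase-submatrix : ∀ {m k m' k'} {M : Matrix m k} {r : Fin m' → Fin m} {c : Fin k' → Fin k} →
                      Staircase M → r Preserves F._≤_ ⟶ F._≤_ → c Preserves F._≤_ ⟶ F._≤_ →
                      Staircase (λ a b → M (r a) (c b))
staircase-submatrix S r-mono c-mono = record
  { entry-01       = λ a b → entry-01 S _ _
  ; ones-down-left = λ a≤a' b'≤b → ones-down-left S (r-mono a≤a') (c-mono b'≤b)
  }

punchIn≡suc⊎≤ : ∀ {k} (j : Fin (suc k)) (b : Fin k) →
                punchIn j b ≡ suc b ⊎ (punchIn j b F.≤ j × suc b F.≤ j)
punchIn≡suc⊎≤ zero    b       = inj₁ refl
punchIn≡suc⊎≤ (suc j) zero    = inj₂ (z≤n , s≤s z≤n)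
punchIn≡suc⊎≤ (suc j) (suc b) =
  ⊎-map (cong suc) (λ (p≤j , sb≤j) → s≤s p≤j , s≤s sb≤j) (punchIn≡suc⊎≤ j b)

-- A 1 in column j of the first row makes columns 0, …, j of all lower rows equal to 1, so
-- deleting any one of these columns leaves the same minor.
det-staircase-expand : ∀ k {M : Matrix (suc k) (suc k)} → Staircase M →
  det (suc k) M ≡ (∑ (suc k) λ j → sign (toℕ j) * M zero j) * det k (λ a b → M (suc a) (suc b))
det-staircase-expand k {M} S =
  trans (∑-cong (suc k) term) (∑-*ʳ (suc k) (λ j → sign (toℕ j) * M zero j) (det k (minor zero)))
  where
  minor : Fin (suc k) → Matrix k k
  minor j a b = M (suc a) (punchIn j b)
  minor-stable : ∀ {j} → M zero j ≡ 1ℤ → ∀ a b → minor j a b ≡ minor zero a b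
  minor-stable {j} M₀ⱼ≡1 a b with punchIn≡suc⊎≤ j b
  ... | inj₁ p≡sb         = cong (M (suc a)) p≡sb
  ... | inj₂ (p≤j , sb≤j) =
    trans (ones-down-left S z≤n p≤j M₀ⱼ≡1) (sym (ones-down-left S z≤n sb≤j M₀ⱼ≡1))
  term : ∀ j → sign (toℕ j) * M zero j * det k (minor j) ≡
               sign (toℕ j) * M zero j * det k (minor zero)
  term j with entry-01 S zero j
  ... | inj₁ M₀ⱼ≡0 rewrite M₀ⱼ≡0 | ℤP.*-zeroʳ (sign (toℕ j)) = refl
  ... | inj₂ M₀ⱼ≡1 = cong (sign (toℕ j) * M zero j *_) (det-cong k (minor-stable M₀ⱼ≡1))

det-staircase : ∀ k {M : Matrix k k} → Staircase M → Is01 (det k M)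
det-staircase zero    S = inj₂ refl
det-staircase (suc k) S = subst Is01 (sym (det-staircase-expand k S))
  (Is01-* (alternating-sum-01 (suc k) _ (entry-01 S zero) (ones-down-left S z≤n))
          (det-staircase k (staircase-submatrix S s≤s s≤s)))

antiAdjacency-staircase : ∀ {n} (P : FinPoset n) →
  (∀ {i i' j j'} → i F.≤ i' → j' F.≤ j → FinPoset._≺_ P i' j' → FinPoset._≺_ P i j) →
  Staircase (antiAdjacency P)
antiAdjacency-staircase P ≺-closed = record
  { entry-01       = antiAdjacency-01
  ; ones-down-left = antiAdjacency-ones-down-left
  }
  where
  open FinPoset P using (_≺_; _≺?_)
  antiAdjacency-01 : ∀ i j → Is01 (antiAdjacency P i j)
  antiAdjacency-01 i j with i ≺? j
  ... | yes _ = inj₁ refl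
  ... | no _  = inj₂ refl
  ≺⇒antiAdjacency≡0 : ∀ {i j} → i ≺ j → antiAdjacency P i j ≡ 0ℤ
  ≺⇒antiAdjacency≡0 {i} {j} i≺j with i ≺? j
  ... | yes _  = refl
  ... | no i⊀j = contradiction i≺j i⊀j
  antiAdjacency-ones-down-left : ∀ {i i' j j'} → i F.≤ i' → j' F.≤ j →
                                 antiAdjacency P i j ≡ 1ℤ → antiAdjacency P i' j' ≡ 1ℤ
  antiAdjacency-ones-down-left {i' = i'} {j' = j'} i≤i' j'≤j Aᵢⱼ≡1 with i' ≺? j'
  ... | yes i'≺j' =
    contradiction (trans (sym Aᵢⱼ≡1) (≺⇒antiAdjacency≡0 (≺-closed i≤i' j'≤j i'≺j'))) λ ()
  ... | no _ = refl

strictlyIncreasing⇒mono : ∀ {k m} {f : Fin k → Fin m} → StrictlyIncreasing f →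
                          f Preserves F._≤_ ⟶ F._≤_
strictlyIncreasing⇒mono f↑ {a} {a'} a≤a' with a FP.≟ a'
... | yes refl = FP.≤-refl
... | no a≢a'  = <⇒≤ (f↑ a a' (FP.≤∧≢⇒< a≤a' a≢a'))

proposition3p4 : (n : ℕ) (P : FinPoset n) → IsUnitIntervalOrder P → BetaSorted P →
    TotallyNonnegative (antiAdjacency P)
proposition3p4 n P (no3+1 , no2+2) sorted k r c r↑ c↑ =
  Is01⇒0≤ (det-staircase k (staircase-submatrix A-staircase
    (strictlyIncreasing⇒mono r↑) (strictlyIncreasing⇒mono c↑)))
  where
  A-staircase : Staircase (antiAdjacency P)
  A-staircase = antiAdjacency-staircase P (UnitIntervalOrder.≺-closed P no3+1 no2+2 sorted)
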